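{- Let $\mathbf{w}$ and $\mathbf{w}'$ be two odd closed walks in a signed graph $(G,\tau)$ with the same first vertex term. Then $\mathbf{w}+\mathbf{w}'$ and $\mathbf{w}^{ -1}+\mathbf{w}'$ are even closed walks in $(G,\tau)$, and $B_{\mathbf{w}^{ -1}+\mathbf{w}'}=\pm B_{\mathbf{w}+\mathbf{w}'}$.
   Context: Graphs are finite and simple; a sign $\tau$ of $G$ assigns $1$ or $-1$ to each pair $(e,v)$ with $v$ an endpoint of edge $e$. A walk $v_1e_1v_2\cdots e_tv_{t+1}$ has $e_i=v_iv_{i+1}$; closed if $v_{t+1}=v_1$. $\mathbf{w}+\mathbf{w}'$ is concatenation and $\mathbf{w}^{ -1}$ the reversed walk. For a closed walk $v_1e_1\cdots e_tv_1$ ($t\ge2$), a vertex term $v_i$ is unbalanced if $\tau(e_{i-1},v_i)\tau(e_i,v_i)=1$ (indices cyclic); the walk is even (resp. odd) if it has an even (resp. odd) number of unbalanced vertex terms. A balanced section of a closed walk is a maximal section (consecutive terms, cyclically) with no internal unbalanced vertex term. An even closed walk $\mathbf{x}$ with an unbalanced vertex term, started at one, decomposes uniquely into consecutive balanced sections $\mathbf{x}_0,\dots,\mathbf{x}_{2k-1}$, and $B_{\mathbf{x}}=\prod_{i\text{ even}}\prod_{e\in E(\mathbf{x}_i)}e-\prod_{i\text{ odd}}\prod_{e\in E(\mathbf{x}_i)}e$ (edges with multiplicity, as variables of a polynomial ring over a field); if $\mathbf{x}$ has no unbalanced vertex term, $B_{\mathbf{x}}=\prod_{e\in E(\mathbf{x})}e-1$.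 $B_{\mathbf{x}}$ is determined up to sign. -}

module Defs where

open import Level using (Level)
open import Data.Nat using (ℕ; _≤_)
open import Data.Fin using (Fin)
open import Data.Bool using (Bool; true; false; not; _xor_; if_then_else_)
open import Data.List using (List; []; _∷_; _++_; map; length; foldr; filterᵇ)
open import Data.Product using (_×_; _,_; proj₁; proj₂; Σ)
open import Data.Sum using (_⊎_)
open import Data.Unit using (⊤)
open import Relation.Binary.PropositionalEquality using (_≡_; _≢_)
open import Algebra.Bundles using (CommutativeRing)

record Graph : Set where
  field
    n m  : ℕ
    src  : Fin m → Fin n
    tgt  : Fin m → Fin n
    loopless : ∀ e → src e ≢ tgt e
    simple   : ∀ e f →
      ((src e ≡ src f × tgt e ≡ tgt f) ⊎ (src e ≡ tgt f × tgt e ≡ src f)) → e ≡ f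

module _ (G : Graph) where
  open Graph G

  V : Set
  V = Fin n

  E : Set
  E = Fin m

  -- A sign of G: τ e v ∈ {1,-1} encoded as Bool (true = 1, false = -1).
  -- Only the values at endpoints v of e are ever used.
  Sign : Set
  Sign = E → V → Bool

  Joins : E → V → V → Set
  Joins e a b = (src e ≡ a × tgt e ≡ b) ⊎ (src e ≡ b × tgt e ≡ a)

  -- A walk v₁ e₁ v₂ … e_t v_{t+1}: first vertex term and the list of
  -- steps (e_i , v_{i+1}).
  record Walk : Set where
    constructor walk
    field
      start : V
      steps : List (E × V)

  open Walk public

  IsWalkFrom : V → List (E × V) → Set
  IsWalkFrom v [] = ⊤
  IsWalkFrom v ((e , v') ∷ rest) = Joins e v v' × IsWalkFrom v' rest

  lastV : V → List (E × V) → V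
  lastV v [] = v
  lastV v ((e , v') ∷ rest) = lastV v' rest

  lastE : E → List (E × V) → E
  lastE e [] = e
  lastE e ((e' , _) ∷ rest) = lastE e' rest

  IsWalk : Walk → Set
  IsWalk w = IsWalkFrom (start w) (steps w)

  len : Walk → ℕ
  len w = length (steps w)

  -- closed walk with t ≥ 2 (the setting in which parity is defined)
  IsClosedWalk : Walk → Set
  IsClosedWalk w = IsWalk w × lastV (start w) (steps w) ≡ start w × 2 ≤ len w

  -- concatenation w + w' (used when the last vertex of w is the first of w')
  _+w_ : Walk → Walk → Walk
  w +w w' = walk (start w) (steps w ++ steps w')

  private
    revGo : List (E × V) → V → List (E × V) → Walk
    revGo acc prev [] = walk prev acc
    revGo acc prev ((e , v) ∷ rest) = revGo ((e , prev) ∷ acc) v rest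

  _⁻¹ : Walk → Walk
  w ⁻¹ = revGo [] (start w) (steps w)

  module _ (τ : Sign) where

    -- v is an unbalanced vertex term between edges a and b:
    -- τ(a,v) τ(b,v) = 1, i.e. the two signs agree
    unbalancedAt : E → V → E → Bool
    unbalancedAt a v b = not (τ a v xor τ b v)

    private
      innerUb : E × V → List (E × V) → List Bool
      innerUb (e , v) [] = []
      innerUb (e , v) ((e' , v') ∷ rest) = unbalancedAt e v e' ∷ innerUb (e' , v') rest

    -- For a closed walk v₁ e₁ v₂ … e_t v₁: the list of flags
    -- [unbalanced(v₁), …, unbalanced(v_t)] (indices cyclic: e₀ = e_t).
    ubFlags : Walk → List Bool
    ubFlags (walk s []) = []
    ubFlags (walk s ((e , v) ∷ rest)) =
      unbalancedAt (lastE e rest) s e ∷ innerUb (e , v) rest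

    ubParity : Walk → Bool
    ubParity w = foldr _xor_ false (ubFlags w)

    IsOddClosedWalk : Walk → Set
    IsOddClosedWalk w = IsClosedWalk w × ubParity w ≡ true

    IsEvenClosedWalk : Walk → Set
    IsEvenClosedWalk w = IsClosedWalk w × ubParity w ≡ false

    -- Balanced-section labelling: edge e_i gets the parity of the number of
    -- unbalanced vertex terms among v₁,…,v_i.  For an even closed walk the
    -- edges with equal label are exactly the edges of the balanced sections
    -- x_j with j of one fixed parity (sections counted from any unbalanced
    -- vertex term); with no unbalanced term all labels are false.
    labelEdges : Bool → List Bool → List E → List (Bool × E)
    labelEdges p (u ∷ us) (e ∷ es) = (p xor u , e) ∷ labelEdges (p xor u) us es
    labelEdges p _ _ = []

    labelled : Walk → List (Bool × E)
    labelled w = labelEdges false (ubFlags w) (map proj₁ (steps w))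

    edgesWithLabel : Bool → Walk → List E
    edgesWithLabel b w =
      map proj₂ (filterᵇ (λ le → not (proj₁ le xor b)) (labelled w))

    -- The binomial B_x, evaluated in a commutative ring R at an assignment
    -- val of ring elements to the edge variables:
    --   B_x = ∏_{even sections} e − ∏_{odd sections} e   (up to sign),
    -- which for a walk without unbalanced vertex terms is ∏ e − 1.
    module _ {c ℓ : Level} (R : CommutativeRing c ℓ) where
      open CommutativeRing R using (Carrier; _*_; _-_; 1#)

      prodR : List Carrier → Carrier
      prodR = foldr _*_ 1#

      B : (E → Carrier) → Walk → Carrier
      B val x = prodR (map val (edgesWithLabel false x))
              - prodR (map val (edgesWithLabel true x))

-- Call an edge negative when its two signs agree.  The unbalanced-vertex flags of a closed walk
-- telescope, so a closed walk is odd iff it has an odd number of negative edges; this count is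
-- additive under concatenation and invariant under reversal, whence w + w' and w⁻¹ + w' are even.
-- In closed form, the section label of an edge is a fixed bit plus the number of negative edges
-- before it plus its sign at its tail.  When w is odd, traversing w backwards yields exactly the
-- labels of w in reverse order, so both concatenations carry the same multiset of labelled edges
-- and in fact B_{w⁻¹+w'} = B_{w+w'}.

module Submission where

open import Defs
open import Level using (Level)
open import Data.Product using (_×_; _,_; proj₁; proj₂)
open import Data.Sum using (_⊎_; inj₁; swap)
open import Relation.Binary.PropositionalEquality
  using (_≡_; refl; sym; trans; cong; cong₂; subst; module ≡-Reasoning)
open import Algebra.Bundles using (CommutativeRing)
open import Data.Bool using (Bool; true; false; not; _xor_)
open import Data.Bool.Properties using (xor-assoc; xor-comm; xor-identityʳ; xor-same)
open import Data.Bool.Solver using (module xor-∧-Solver)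
open import Data.Nat using (_+_; _≤_)
open import Data.Nat.Properties using (+-comm; ≤-trans)
open import Data.List using (List; []; _∷_; _++_; [_]; map; foldr; length; reverse)
open import Data.List.Properties using (++-assoc; length-++; length-++-≤ʳ; unfold-reverse; ∷-injectiveʳ)
open import Data.List.Relation.Binary.Permutation.Propositional
  using (_↭_; ↭⇒↭ₛ′; module PermutationReasoning)
open import Data.List.Relation.Binary.Permutation.Propositional.Properties
  using (++⁺ʳ; map⁺; filter-↭; ↭-reverse)
open import Data.Unit using (tt)

module Walks (G : Graph) where

  Steps : Set
  Steps = List (E G × V G)

  reverseSteps : V G → Steps → Steps
  reverseSteps s [] = []
  reverseSteps s ((e , v) ∷ r) = reverseSteps v r ++ [ e , s ]

  lastV-++ : ∀ s A B → lastV G s (A ++ B) ≡ lastV G (lastV G s A) B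
  lastV-++ s [] B = refl
  lastV-++ s ((e , v) ∷ A) B = lastV-++ v A B

  lastE-++-∷ : ∀ p A e v r → lastE G p (A ++ (e , v) ∷ r) ≡ lastE G e r
  lastE-++-∷ p [] e v r = refl
  lastE-++-∷ p ((e′ , v′) ∷ A) e v r = lastE-++-∷ e′ A e v r

  IsWalkFrom-++ : ∀ {s} A {B} → IsWalkFrom G s A → IsWalkFrom G (lastV G s A) B → IsWalkFrom G s (A ++ B)
  IsWalkFrom-++ [] _ walkB = walkB
  IsWalkFrom-++ (_ ∷ A) (joins , walkA) walkB = joins , IsWalkFrom-++ A walkA walkB

  lastV-reverseSteps : ∀ s L → lastV G (lastV G s L) (reverseSteps s L) ≡ s
  lastV-reverseSteps s [] = refl
  lastV-reverseSteps s ((e , v) ∷ r) = lastV-++ (lastV G v r) (reverseSteps v r) [ e , s ]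

  length-reverseSteps : ∀ s L → length (reverseSteps s L) ≡ length L
  length-reverseSteps s [] = refl
  length-reverseSteps s ((e , v) ∷ r) = begin
    length (reverseSteps v r ++ [ e , s ])  ≡⟨ length-++ (reverseSteps v r) ⟩
    length (reverseSteps v r) + 1           ≡⟨ cong (_+ 1) (length-reverseSteps v r) ⟩
    length r + 1                            ≡⟨ +-comm (length r) 1 ⟩
    length ((e , v) ∷ r)                    ∎
    where open ≡-Reasoning

  IsWalkFrom-reverseSteps : ∀ {s} L → IsWalkFrom G s L → IsWalkFrom G (lastV G s L) (reverseSteps s L)
  IsWalkFrom-reverseSteps [] _ = tt
  IsWalkFrom-reverseSteps {s} ((e , v) ∷ r) (joins , walk-r) =
    IsWalkFrom-++ (reverseSteps v r) (IsWalkFrom-reverseSteps r walk-r)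
      (subst (λ u → IsWalkFrom G u [ e , s ]) (sym (lastV-reverseSteps v r)) (swap joins , tt))

  -- Defs implements `_⁻¹` by a private accumulating loop; abstracting the accumulator with `with`
  -- lets unification solve `reverseOnto` to that loop.
  mutual
    reverseOnto : Steps → V G → Steps → Walk G
    reverseOnto = _

    ⁻¹-∷ : ∀ s e v r → _⁻¹ G (walk s ((e , v) ∷ r)) ≡ reverseOnto [ e , s ] v r
    ⁻¹-∷ s e v r with [ e , s ]
    ... | acc = refl

  reverseOnto-≡ : ∀ acc p L → reverseOnto acc p L ≡ walk (lastV G p L) (reverseSteps p L ++ acc)
  reverseOnto-≡ acc p [] = refl
  reverseOnto-≡ acc p ((e , v) ∷ r) =
    trans (reverseOnto-≡ ((e , p) ∷ acc) v r)
          (cong (walk (lastV G v r)) (sym (++-assoc (reverseSteps v r) [ e , p ] acc)))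

  ⁻¹-walk : ∀ s L → _⁻¹ G (walk s L) ≡ walk (lastV G s L) (reverseSteps s L)
  ⁻¹-walk s [] = refl
  ⁻¹-walk s ((e , v) ∷ r) = trans (⁻¹-∷ s e v r) (reverseOnto-≡ [ e , s ] v r)

  ⁻¹-closed : ∀ s L → lastV G s L ≡ s → _⁻¹ G (walk s L) ≡ walk s (reverseSteps s L)
  ⁻¹-closed s L closed = trans (⁻¹-walk s L) (cong (λ u → walk u (reverseSteps s L)) closed)

  start-⁻¹ : ∀ {w} → IsClosedWalk G w → start (_⁻¹ G w) ≡ start w
  start-⁻¹ {walk s L} (_ , closed , _) = cong start (⁻¹-closed s L closed)

module SignedWalks (G : Graph) (τ : Sign G) where
  open Walks G
  open xor-∧-Solver using (solve; _:=_; _:+_; con)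

  negative : E G → V G → V G → Bool
  negative e a b = not (τ e a xor τ e b)

  negativeParity : V G → Steps → Bool
  negativeParity s [] = false
  negativeParity s ((e , v) ∷ r) = negative e s v xor negativeParity v r

  negativeParity-++ : ∀ s A B →
    negativeParity s (A ++ B) ≡ negativeParity s A xor negativeParity (lastV G s A) B
  negativeParity-++ s [] B = refl
  negativeParity-++ s ((e , v) ∷ A) B =
    trans (cong (negative e s v xor_) (negativeParity-++ v A B))
          (sym (xor-assoc (negative e s v) (negativeParity v A) _))

  negative-sym : ∀ e a b → negative e a b ≡ negative e b a
  negative-sym e a b = cong not (xor-comm (τ e a) (τ e b))

  negativeParity-reverseSteps : ∀ s L → negativeParity (lastV G s L) (reverseSteps s L) ≡ negativeParity s L
  negativeParity-reverseSteps s [] = refl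
  negativeParity-reverseSteps s ((e , v) ∷ r) = begin
    negativeParity (lastV G v r) (reverseSteps v r ++ [ e , s ])
      ≡⟨ negativeParity-++ (lastV G v r) (reverseSteps v r) [ e , s ] ⟩
    negativeParity (lastV G v r) (reverseSteps v r)
      xor negative e (lastV G (lastV G v r) (reverseSteps v r)) s xor false
      ≡⟨ cong₂ (λ n u → n xor negative e u s xor false)
               (negativeParity-reverseSteps v r) (lastV-reverseSteps v r) ⟩
    negativeParity v r xor negative e v s xor false
      ≡⟨ cong (λ n → negativeParity v r xor n) (trans (xor-identityʳ _) (negative-sym e v s)) ⟩
    negativeParity v r xor negative e s v
      ≡⟨ xor-comm (negativeParity v r) _ ⟩
    negative e s v xor negativeParity v r ∎
    where open ≡-Reasoning

  flagsFrom : E G → V G → Steps → List Bool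
  flagsFrom p s [] = []
  flagsFrom p s ((e , v) ∷ r) = unbalancedAt G τ p s e ∷ flagsFrom e v r

  ubFlags≡flagsFrom : ∀ p s L → ubFlags G τ (walk s L) ≡ flagsFrom (lastE G p L) s L
  ubFlags≡flagsFrom p s [] = refl
  ubFlags≡flagsFrom p s ((e , v) ∷ []) = refl
  ubFlags≡flagsFrom p s ((e , v) ∷ (e′ , v′) ∷ r) =
    cong (λ fs → unbalancedAt G τ (lastE G e′ r) s e ∷ unbalancedAt G τ e v e′ ∷ fs)
         (∷-injectiveʳ (ubFlags≡flagsFrom p v ((e′ , v′) ∷ r)))

  -- Regroup the signs in the flags by edge instead of by vertex: each edge e from a to b contributes
  -- ¬(τ(e,a) + τ(e,b)), and only the two outermost signs are left over.
  xor-flagsFrom : ∀ p s L →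
    foldr _xor_ false (flagsFrom p s L) ≡ τ p s xor negativeParity s L xor τ (lastE G p L) (lastV G s L)
  xor-flagsFrom p s [] = sym (xor-same (τ p s))
  xor-flagsFrom p s ((e , v) ∷ r) =
    trans (cong (unbalancedAt G τ p s e xor_) (xor-flagsFrom e v r))
          (solve 5 (λ a b c n z → (con true :+ (a :+ b)) :+ (c :+ (n :+ z))
                               := a :+ (((con true :+ (b :+ c)) :+ n) :+ z))
                 refl (τ p s) (τ e s) (τ e v) (negativeParity v r) (τ (lastE G e r) (lastV G v r)))

  ubParity-closed : ∀ s L → lastV G s L ≡ s → ubParity G τ (walk s L) ≡ negativeParity s L
  ubParity-closed s [] _ = refl
  ubParity-closed s L@((e , v) ∷ r) closed = begin
    ubParity G τ (walk s L)
      ≡⟨ cong (foldr _xor_ false) (ubFlags≡flagsFrom e s L) ⟩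
    foldr _xor_ false (flagsFrom p s L)
      ≡⟨ xor-flagsFrom p s L ⟩
    τ p s xor negativeParity s L xor τ p (lastV G s L)
      ≡⟨ cong (λ u → τ p s xor negativeParity s L xor τ p u) closed ⟩
    τ p s xor negativeParity s L xor τ p s
      ≡⟨ solve 2 (λ a n → a :+ (n :+ a) := n) refl (τ p s) (negativeParity s L) ⟩
    negativeParity s L ∎
    where
    open ≡-Reasoning
    p : E G
    p = lastE G e r

  -- For a closed walk v₁ e₁ … e_t v₁, k is τ(e_t,v₁), the sign of the closing edge at v₁.
  labelsFrom : Bool → V G → Steps → List (Bool × E G)
  labelsFrom k s [] = []
  labelsFrom k s ((e , v) ∷ r) = (k xor not (τ e s) , e) ∷ labelsFrom (k xor negative e s v) v r

  labelEdges-flagsFrom : ∀ b p s L →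
    labelEdges G τ b (flagsFrom p s L) (map proj₁ L) ≡ labelsFrom (b xor τ p s) s L
  labelEdges-flagsFrom b p s [] = refl
  labelEdges-flagsFrom b p s ((e , v) ∷ r) =
    cong₂ (λ l ls → (l , e) ∷ ls)
      (solve 3 (λ b a c → b :+ (con true :+ (a :+ c)) := (b :+ a) :+ (con true :+ c))
             refl b (τ p s) (τ e s))
      (trans (labelEdges-flagsFrom _ e v r)
             (cong (λ k → labelsFrom k v r)
                   (solve 4 (λ b a c d → (b :+ (con true :+ (a :+ c))) :+ d
                                       := (b :+ a) :+ (con true :+ (c :+ d)))
                          refl b (τ p s) (τ e s) (τ e v))))

  labelled≡labelsFrom : ∀ p s L → labelled G τ (walk s L) ≡ labelsFrom (τ (lastE G p L) s) s L
  labelled≡labelsFrom p s L =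
    trans (cong (λ fs → labelEdges G τ false fs (map proj₁ L)) (ubFlags≡flagsFrom p s L))
          (labelEdges-flagsFrom false (lastE G p L) s L)

  labelsFrom-++ : ∀ k s A B →
    labelsFrom k s (A ++ B) ≡ labelsFrom k s A ++ labelsFrom (k xor negativeParity s A) (lastV G s A) B
  labelsFrom-++ k s [] B = cong (λ k′ → labelsFrom k′ s B) (sym (xor-identityʳ k))
  labelsFrom-++ k s ((e , v) ∷ A) B =
    cong ((k xor not (τ e s) , e) ∷_)
      (trans (labelsFrom-++ (k xor negative e s v) v A B)
             (cong (λ k′ → labelsFrom _ v A ++ labelsFrom k′ (lastV G v A) B)
                   (xor-assoc k (negative e s v) (negativeParity v A))))

  labelsFrom-reverseSteps : ∀ k s L →
    labelsFrom (k xor not (negativeParity s L)) (lastV G s L) (reverseSteps s L) ≡ reverse (labelsFrom k s L)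
  labelsFrom-reverseSteps k s [] = refl
  labelsFrom-reverseSteps k s ((e , v) ∷ r) = begin
    labelsFrom k′ (lastV G v r) (reverseSteps v r ++ [ e , s ])
      ≡⟨ labelsFrom-++ k′ (lastV G v r) (reverseSteps v r) [ e , s ] ⟩
    labelsFrom k′ (lastV G v r) (reverseSteps v r)
      ++ [ (k′ xor negativeParity (lastV G v r) (reverseSteps v r))
             xor not (τ e (lastV G (lastV G v r) (reverseSteps v r))) , e ]
      ≡⟨ cong₂ _++_ (cong (λ k″ → labelsFrom k″ (lastV G v r) (reverseSteps v r)) k′≡)
                    (cong₂ (λ n u → [ (k′ xor n) xor not (τ e u) , e ])
                           (negativeParity-reverseSteps v r) (lastV-reverseSteps v r)) ⟩
    labelsFrom (k₁ xor not (negativeParity v r)) (lastV G v r) (reverseSteps v r)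
      ++ [ (k′ xor negativeParity v r) xor not (τ e v) , e ]
      ≡⟨ cong₂ _++_ (labelsFrom-reverseSteps k₁ v r) (cong (λ l → [ l , e ]) last-label) ⟩
    reverse (labelsFrom k₁ v r) ++ [ k xor not (τ e s) , e ]
      ≡⟨ unfold-reverse _ (labelsFrom k₁ v r) ⟨
    reverse (labelsFrom k s ((e , v) ∷ r)) ∎
    where
    open ≡-Reasoning
    k₁ k′ : Bool
    k₁ = k xor negative e s v
    k′ = k xor not (negativeParity s ((e , v) ∷ r))
    k′≡ : k′ ≡ k₁ xor not (negativeParity v r)
    k′≡ = solve 4 (λ k a b n → k :+ (con true :+ ((con true :+ (a :+ b)) :+ n))
                             := (k :+ (con true :+ (a :+ b))) :+ (con true :+ n))
                  refl k (τ e s) (τ e v) (negativeParity v r)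
    last-label : (k′ xor negativeParity v r) xor not (τ e v) ≡ k xor not (τ e s)
    last-label = solve 4 (λ k a b n → ((k :+ (con true :+ ((con true :+ (a :+ b)) :+ n))) :+ n) :+ (con true :+ b)
                                    := k :+ (con true :+ a))
                         refl k (τ e s) (τ e v) (negativeParity v r)

  negativeParity-odd : ∀ {s L} → IsOddClosedWalk G τ (walk s L) → negativeParity s L ≡ true
  negativeParity-odd {s} {L} ((_ , closed , _) , odd) = trans (sym (ubParity-closed s L closed)) odd

  labelsFrom-reverseSteps-odd : ∀ k {s L} → IsOddClosedWalk G τ (walk s L) →
    labelsFrom k s (reverseSteps s L) ≡ reverse (labelsFrom k s L)
  labelsFrom-reverseSteps-odd k {s} {L} odd@((_ , closed , _) , _) =
    trans (cong₂ (λ k′ u → labelsFrom k′ u (reverseSteps s L)) (sym k≡) (sym closed))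
          (labelsFrom-reverseSteps k s L)
    where
    k≡ : k xor not (negativeParity s L) ≡ k
    k≡ = trans (cong (λ n → k xor not n) (negativeParity-odd odd)) (xor-identityʳ k)

  labelled-odd-++ : ∀ {s A} e v r → IsOddClosedWalk G τ (walk s A) →
    let k = τ (lastE G e r) s in
    labelled G τ (walk s (A ++ (e , v) ∷ r)) ≡ labelsFrom k s A ++ labelsFrom (k xor true) s ((e , v) ∷ r)
  labelled-odd-++ {s} {A} e v r odd@((_ , closed , _) , _) = begin
    labelled G τ (walk s (A ++ L′))
      ≡⟨ labelled≡labelsFrom e s (A ++ L′) ⟩
    labelsFrom (τ (lastE G e (A ++ L′)) s) s (A ++ L′)
      ≡⟨ cong (λ p → labelsFrom (τ p s) s (A ++ L′)) (lastE-++-∷ e A e v r) ⟩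
    labelsFrom k s (A ++ L′)
      ≡⟨ labelsFrom-++ k s A L′ ⟩
    labelsFrom k s A ++ labelsFrom (k xor negativeParity s A) (lastV G s A) L′
      ≡⟨ cong₂ (λ n u → labelsFrom k s A ++ labelsFrom (k xor n) u L′) (negativeParity-odd odd) closed ⟩
    labelsFrom k s A ++ labelsFrom (k xor true) s L′ ∎
    where
    open ≡-Reasoning
    L′ : Steps
    L′ = (e , v) ∷ r
    k : Bool
    k = τ (lastE G e r) s

  odd+odd-even : ∀ {w w′} → IsOddClosedWalk G τ w → IsOddClosedWalk G τ w′ → start w ≡ start w′ →
    IsEvenClosedWalk G τ (_+w_ G w w′)
  odd+odd-even {walk s L} {walk _ L′} odd@((walk-L , closed , _) , _)
               odd′@((walk-L′ , closed′ , long′) , _) refl =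
    (walk-++ , closed-++ , ≤-trans long′ (length-++-≤ʳ L′ {L})) , even
    where
    walk-++ : IsWalkFrom G s (L ++ L′)
    walk-++ = IsWalkFrom-++ L walk-L (subst (λ u → IsWalkFrom G u L′) (sym closed) walk-L′)
    closed-++ : lastV G s (L ++ L′) ≡ s
    closed-++ = trans (lastV-++ s L L′) (trans (cong (λ u → lastV G u L′) closed) closed′)
    even : ubParity G τ (walk s (L ++ L′)) ≡ false
    even = begin
      ubParity G τ (walk s (L ++ L′))                        ≡⟨ ubParity-closed s (L ++ L′) closed-++ ⟩
      negativeParity s (L ++ L′)                             ≡⟨ negativeParity-++ s L L′ ⟩
      negativeParity s L xor negativeParity (lastV G s L) L′ ≡⟨ cong₂ (λ n u → n xor negativeParity u L′)
                                                                       (negativeParity-odd odd) closed ⟩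
      true xor negativeParity s L′                           ≡⟨ cong (true xor_) (negativeParity-odd odd′) ⟩
      false                                                  ∎
      where open ≡-Reasoning

  ⁻¹-odd : ∀ {w} → IsOddClosedWalk G τ w → IsOddClosedWalk G τ (_⁻¹ G w)
  ⁻¹-odd {walk s L} odd@((walk-L , closed , long) , _) =
    subst (IsOddClosedWalk G τ) (sym (⁻¹-walk s L))
      ((IsWalkFrom-reverseSteps L walk-L , closed-R , long-R) , odd-R)
    where
    closed-R : lastV G (lastV G s L) (reverseSteps s L) ≡ lastV G s L
    closed-R = trans (lastV-reverseSteps s L) (sym closed)
    long-R : 2 ≤ length (reverseSteps s L)
    long-R = subst (2 ≤_) (sym (length-reverseSteps s L)) long
    odd-R : ubParity G τ (walk (lastV G s L) (reverseSteps s L)) ≡ true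
    odd-R = trans (ubParity-closed (lastV G s L) (reverseSteps s L) closed-R)
                  (trans (negativeParity-reverseSteps s L) (negativeParity-odd odd))

  labelled-⁻¹-+w : ∀ {w w′} → IsOddClosedWalk G τ w → IsClosedWalk G w′ →
    labelled G τ (_+w_ G (_⁻¹ G w) w′) ↭ labelled G τ (_+w_ G w w′)
  labelled-⁻¹-+w {walk s L} {walk _ []} _ (_ , _ , ())
  labelled-⁻¹-+w {walk s L} {walk s′ ((e , v) ∷ r)} odd@((_ , closed , _) , _) _ = begin
    labelled G τ (_+w_ G (_⁻¹ G (walk s L)) (walk s′ L′))
      ≡⟨ cong (λ x → labelled G τ (_+w_ G x (walk s′ L′))) (⁻¹-closed s L closed) ⟩
    labelled G τ (walk s (reverseSteps s L ++ L′))
      ≡⟨ labelled-odd-++ e v r odd-R ⟩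
    labelsFrom k s (reverseSteps s L) ++ M
      ≡⟨ cong (_++ M) (labelsFrom-reverseSteps-odd k odd) ⟩
    reverse (labelsFrom k s L) ++ M
      ↭⟨ ++⁺ʳ M (↭-reverse (labelsFrom k s L)) ⟩
    labelsFrom k s L ++ M
      ≡⟨ labelled-odd-++ e v r odd ⟨
    labelled G τ (walk s (L ++ L′)) ∎
    where
    open PermutationReasoning
    L′ : Steps
    L′ = (e , v) ∷ r
    k : Bool
    k = τ (lastE G e r) s
    M : List (Bool × E G)
    M = labelsFrom (k xor true) s L′
    odd-R : IsOddClosedWalk G τ (walk s (reverseSteps s L))
    odd-R = subst (IsOddClosedWalk G τ) (⁻¹-closed s L closed) (⁻¹-odd odd)

  edgesWithLabel-↭ : ∀ b {x y} → labelled G τ x ↭ labelled G τ y →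
    edgesWithLabel G τ b x ↭ edgesWithLabel G τ b y
  edgesWithLabel-↭ b p = map⁺ proj₂ (filter-↭ _ p)

  module _ {c ℓ : Level} (R : CommutativeRing c ℓ) where
    open CommutativeRing R using (_≈_; +-cong; -‿cong; isEquivalence; setoid; *-isCommutativeMonoid)
    open import Data.List.Relation.Binary.Permutation.Setoid.Properties setoid using (foldr-commMonoid)

    prodR-↭ : ∀ {xs ys} → xs ↭ ys → prodR G τ R xs ≈ prodR G τ R ys
    prodR-↭ p = foldr-commMonoid *-isCommutativeMonoid (↭⇒↭ₛ′ isEquivalence p)

    B-cong-↭ : ∀ val {x y} → labelled G τ x ↭ labelled G τ y → B G τ R val x ≈ B G τ R val y
    B-cong-↭ val p = +-cong (prodR-↭ (map⁺ val (edgesWithLabel-↭ false p)))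
                            (-‿cong (prodR-↭ (map⁺ val (edgesWithLabel-↭ true p))))

lemma4p6 : {c ℓ : Level} (G : Graph) (τ : Sign G) (w w' : Walk G)
    → IsOddClosedWalk G τ w → IsOddClosedWalk G τ w' → start w ≡ start w'
    → IsEvenClosedWalk G τ (_+w_ G w w')
      × IsEvenClosedWalk G τ (_+w_ G (_⁻¹ G w) w')
      × ((R : CommutativeRing c ℓ) (val : E G → CommutativeRing.Carrier R)
         → CommutativeRing._≈_ R (B G τ R val (_+w_ G (_⁻¹ G w) w')) (B G τ R val (_+w_ G w w'))
           ⊎ CommutativeRing._≈_ R (B G τ R val (_+w_ G (_⁻¹ G w) w')) (CommutativeRing.-_ R (B G τ R val (_+w_ G w w'))))
lemma4p6 G τ w w' odd odd′ same-start =
    odd+odd-even odd odd′ same-start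
  , odd+odd-even (⁻¹-odd odd) odd′ (trans (start-⁻¹ (proj₁ odd)) same-start)
  , λ R val → inj₁ (B-cong-↭ R val (labelled-⁻¹-+w odd (proj₁ odd′)))
  where
  open Walks G
  open SignedWalks G τ
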